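{- Let $\mathcal V$ be a variety. Then $\mathcal Q_{\mathcal V}$ is primitive if and only if for every subvariety $\mathcal V_0\subseteq\mathcal V$ with $F_{\mathcal V_0}(\omega)\in\mathcal Q_{\mathcal V}$ one has $\mathcal V_0\cap\mathcal Q_{\mathcal V}=\mathcal Q_{\mathcal V_0}$.
   Context: For a variety $\mathcal W$, $F_{\mathcal W}(\omega)$ is its free algebra of countably infinite rank and $\mathcal Q_{\mathcal W}$ is the quasivariety generated by $F_{\mathcal W}(\omega)$. A quasivariety $\mathcal Q$ is primitive if every subquasivariety $\mathcal Q'\subseteq\mathcal Q$ is a relative variety, i.e. $\mathcal Q'=\mathcal Q\cap\mathcal W$ for some variety $\mathcal W$. -}

module Defs where

open import Data.Nat using (ℕ)
open import Data.Fin using (Fin)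
open import Data.List using (List)
open import Data.List.Relation.Unary.All using (All)
open import Data.Product using (Σ; _×_; _,_; proj₁; proj₂)
open import Relation.Binary.Structures using (IsEquivalence)

record Signature : Set₁ where
  field
    Op    : Set
    arity : Op → ℕ

module Over (S : Signature) where
  open Signature S

  -- Terms in the countably many variables x₀, x₁, … (indexed by ℕ = ω).
  data Term : Set where
    var : ℕ → Term
    op  : (f : Op) → (Fin (arity f) → Term) → Term

  sub : (ℕ → Term) → Term → Term
  sub σ (var n)   = σ n
  sub σ (op f ts) = op f (λ i → sub σ (ts i))

  record Algebra : Set₁ where
    field
      Carrier : Set
      _≈_     : Carrier → Carrier → Set
      isEquiv : IsEquivalence _≈_
      ⟦_⟧     : (f : Op) → (Fin (arity f) → Carrier) → Carrier
      ⟦⟧-cong : ∀ f {xs ys : Fin (arity f) → Carrier} →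
                (∀ i → xs i ≈ ys i) → ⟦ f ⟧ xs ≈ ⟦ f ⟧ ys

  open Algebra

  eval : (A : Algebra) → (ℕ → Carrier A) → Term → Carrier A
  eval A ρ (var n)   = ρ n
  eval A ρ (op f ts) = ⟦ A ⟧ f (λ i → eval A ρ (ts i))

  Equation : Set
  Equation = Term × Term

  HoldsAt : (A : Algebra) → (ℕ → Carrier A) → Equation → Set
  HoldsAt A ρ (s , t) = _≈_ A (eval A ρ s) (eval A ρ t)

  _⊨_ : Algebra → Equation → Set
  A ⊨ e = ∀ ρ → HoldsAt A ρ e

  record QuasiIdentity : Set where
    constructor _⇒_
    field
      premises   : List Equation
      conclusion : Equation

  _⊨q_ : Algebra → QuasiIdentity → Set
  A ⊨q (ps ⇒ c) = ∀ ρ → All (HoldsAt A ρ) ps → HoldsAt A ρ c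

  Theory : Set₁
  Theory = Equation → Set

  QTheory : Set₁
  QTheory = QuasiIdentity → Set

  Class : Set₁
  Class = Algebra → Set

  _⊆_ : Class → Class → Set₁
  K ⊆ L = ∀ A → K A → L A

  _≐_ : Class → Class → Set₁
  K ≐ L = K ⊆ L × L ⊆ K

  _∩_ : Class → Class → Class
  (K ∩ L) A = K A × L A

  Mod : Theory → Class
  Mod E A = ∀ e → E e → A ⊨ e

  QMod : QTheory → Class
  QMod Σq A = ∀ q → Σq q → A ⊨q q

  IsVariety : Class → Set₁
  IsVariety K = Σ Theory (λ E → K ≐ Mod E)

  IsQuasivariety : Class → Set₁
  IsQuasivariety K = Σ QTheory (λ Σq → K ≐ QMod Σq)

  IsRelativeVariety : Class → Class → Set₁
  IsRelativeVariety Q Q' = Σ Class (λ W → IsVariety W × (Q' ≐ (Q ∩ W)))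

  Primitive : Class → Set₁
  Primitive Q = ∀ Q' → IsQuasivariety Q' → Q' ⊆ Q → IsRelativeVariety Q Q'

  -- Quasivariety generated by a single algebra A: the models of all
  -- quasi-identities valid in A.
  QGen : Algebra → Class
  QGen A B = ∀ q → A ⊨q q → B ⊨q q

  data _⊢_≈_ (E : Theory) : Term → Term → Set where
    ax    : ∀ {s t} → E (s , t) → (σ : ℕ → Term) → E ⊢ sub σ s ≈ sub σ t
    refl  : ∀ {s} → E ⊢ s ≈ s
    sym   : ∀ {s t} → E ⊢ s ≈ t → E ⊢ t ≈ s
    trans : ∀ {s t u} → E ⊢ s ≈ t → E ⊢ t ≈ u → E ⊢ s ≈ u
    cong  : ∀ f {ts us : Fin (arity f) → Term} →
            (∀ i → E ⊢ ts i ≈ us i) → E ⊢ op f ts ≈ op f us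

  -- F_V(ω) for V = Mod E: term algebra on ω generators modulo the
  -- fully invariant congruence of consequences of E.
  Free : Theory → Algebra
  Free E = record
    { Carrier = Term
    ; _≈_     = E ⊢_≈_
    ; isEquiv = record { refl = refl ; sym = sym ; trans = trans }
    ; ⟦_⟧     = op
    ; ⟦⟧-cong = cong
    }

  QV : Theory → Class
  QV E = QGen (Free E)

-- (⇒) Q_{V₀} ⊆ Q_V is a subquasivariety, so primitivity gives Q_{V₀} = Q_V ∩ W
-- for a variety W; as F_{V₀}(ω) ∈ W, every identity of W holds in V₀, whence
-- V₀ ∩ Q_V ⊆ Q_V ∩ W = Q_{V₀}; the other inclusion is immediate.
-- (⇐) A subquasivariety Q' ⊆ Q_V has a free algebra F_{V₀}(ω) ∈ Q', where V₀ is
-- the variety defined by the identities derivable from the axioms of Q'. Then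
-- V₀ ⊆ V, Q' ⊆ Q_V ∩ V₀ = Q_{V₀} by hypothesis, and Q_{V₀} ⊆ Q' because Q' is a
-- quasivariety containing F_{V₀}(ω); so Q' is the relative variety Q_V ∩ V₀.
module Submission where

open import Defs
open import Function.Bundles using (_⇔_; mk⇔)
open import Data.Nat using (ℕ)
open import Data.Fin using (Fin)
open import Data.List using ([])
open import Data.List.Relation.Unary.All using (All; []; _∷_)
open import Data.Product using (_,_; proj₁; proj₂)
open import Relation.Binary.Bundles using (Setoid)
import Relation.Binary.Reasoning.Setoid as SetoidReasoning

module _ (S : Signature) where
  open Signature S
  open Over S
  open Algebra

  setoid : Algebra → Setoid _ _
  setoid A = record { Carrier = Carrier A ; _≈_ = _≈_ A ; isEquivalence = isEquiv A }

  ⊆-refl : {K : Class} → K ⊆ K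
  ⊆-refl A a = a

  Mod-isVariety : (E : Theory) → IsVariety (Mod E)
  Mod-isVariety E = E , ⊆-refl , ⊆-refl

  eval-sub : (A : Algebra) (ρ : ℕ → Carrier A) (σ : ℕ → Term) (s : Term) →
             _≈_ A (eval A ρ (sub σ s)) (eval A (λ n → eval A ρ (σ n)) s)
  eval-sub A ρ σ (var n)   = Setoid.refl (setoid A)
  eval-sub A ρ σ (op f ts) = ⟦⟧-cong A f (λ i → eval-sub A ρ σ (ts i))

  HoldsAt-sub : (A : Algebra) (ρ : ℕ → Carrier A) (σ : ℕ → Term) (e : Equation) →
                HoldsAt A (λ n → eval A ρ (σ n)) e →
                HoldsAt A ρ (sub σ (proj₁ e) , sub σ (proj₂ e))
  HoldsAt-sub A ρ σ (s , t) h = begin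
    eval A ρ (sub σ s)               ≈⟨ eval-sub A ρ σ s ⟩
    eval A (λ n → eval A ρ (σ n)) s  ≈⟨ h ⟩
    eval A (λ n → eval A ρ (σ n)) t  ≈⟨ eval-sub A ρ σ t ⟨
    eval A ρ (sub σ t)               ∎
    where open SetoidReasoning (setoid A)

  sub-HoldsAt : (A : Algebra) (ρ : ℕ → Carrier A) (σ : ℕ → Term) (e : Equation) →
                HoldsAt A ρ (sub σ (proj₁ e) , sub σ (proj₂ e)) →
                HoldsAt A (λ n → eval A ρ (σ n)) e
  sub-HoldsAt A ρ σ (s , t) h = begin
    eval A (λ n → eval A ρ (σ n)) s  ≈⟨ eval-sub A ρ σ s ⟨
    eval A ρ (sub σ s)               ≈⟨ h ⟩
    eval A ρ (sub σ t)               ≈⟨ eval-sub A ρ σ t ⟩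
    eval A (λ n → eval A ρ (σ n)) t  ∎
    where open SetoidReasoning (setoid A)

  eval-Free : (E : Theory) (ρ : ℕ → Term) (u : Term) → E ⊢ eval (Free E) ρ u ≈ sub ρ u
  eval-Free E ρ (var n)   = refl
  eval-Free E ρ (op f ts) = cong f (λ i → eval-Free E ρ (ts i))

  sub-var : (E : Theory) (u : Term) → E ⊢ sub var u ≈ u
  sub-var E (var n)   = refl
  sub-var E (op f ts) = cong f (λ i → sub-var E (ts i))

  ⊢-sound : {E : Theory} {A : Algebra} {s t : Term} →
            Mod E A → E ⊢ s ≈ t → A ⊨ (s , t)
  ⊢-sound {A = A} A⊨E (ax {s} {t} e σ) ρ = HoldsAt-sub A ρ σ (s , t) (A⊨E (s , t) e _)
  ⊢-sound {A = A} A⊨E refl ρ = Setoid.refl (setoid A)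
  ⊢-sound {A = A} A⊨E (sym d) ρ = Setoid.sym (setoid A) (⊢-sound {A = A} A⊨E d ρ)
  ⊢-sound {A = A} A⊨E (trans d d′) ρ =
    Setoid.trans (setoid A) (⊢-sound {A = A} A⊨E d ρ) (⊢-sound {A = A} A⊨E d′ ρ)
  ⊢-sound {A = A} A⊨E (cong f ds) ρ = ⟦⟧-cong A f (λ i → ⊢-sound {A = A} A⊨E (ds i) ρ)

  Free∈Mod : (E : Theory) → Mod E (Free E)
  Free∈Mod E (s , t) e ρ = trans (eval-Free E ρ s) (trans (ax e ρ) (sym (eval-Free E ρ t)))

  Free-⊨⇒⊢ : (E : Theory) {s t : Term} → Free E ⊨ (s , t) → E ⊢ s ≈ t
  Free-⊨⇒⊢ E {s} {t} F⊨e = begin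
    s                      ≈⟨ sub-var E s ⟨
    sub var s              ≈⟨ eval-Free E var s ⟨
    eval (Free E) var s    ≈⟨ F⊨e var ⟩
    eval (Free E) var t    ≈⟨ eval-Free E var t ⟩
    sub var t              ≈⟨ sub-var E t ⟩
    t                      ∎
    where open SetoidReasoning (setoid (Free E))

  Free∈Mod⇒Mod⊆ : {E E₀ : Theory} → Mod E (Free E₀) → Mod E₀ ⊆ Mod E
  Free∈Mod⇒Mod⊆ {E₀ = E₀} F₀⊨E A A⊨E₀ (s , t) e =
    ⊢-sound {A = A} A⊨E₀ (Free-⊨⇒⊢ E₀ {s} {t} (F₀⊨E (s , t) e))

  QGen-isQuasivariety : (A : Algebra) → IsQuasivariety (QGen A)
  QGen-isQuasivariety A = (λ q → A ⊨q q) , ⊆-refl , ⊆-refl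

  QGen-⊨ : (A B : Algebra) (e : Equation) → QGen A B → A ⊨ e → B ⊨ e
  QGen-⊨ A B e B∈ A⊨e ρ = B∈ ([] ⇒ e) (λ ρ′ _ → A⊨e ρ′) ρ []

  QGen-∈ : (A : Algebra) → QGen A A
  QGen-∈ A q A⊨q = A⊨q

  QGen-least : {Σq : QTheory} (A : Algebra) → QMod Σq A → QGen A ⊆ QMod Σq
  QGen-least A A⊨Σq B B∈ q q∈Σq = B∈ q (A⊨Σq q q∈Σq)

  QV⊆Mod : (E : Theory) → QV E ⊆ Mod E
  QV⊆Mod E B B∈ e e∈E = QGen-⊨ (Free E) B e B∈ (Free∈Mod E e e∈E)

  infix 4 _⊢q_≈_
  data _⊢q_≈_ (Σq : QTheory) : Term → Term → Set where
    refl  : ∀ {s} → Σq ⊢q s ≈ s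
    sym   : ∀ {s t} → Σq ⊢q s ≈ t → Σq ⊢q t ≈ s
    trans : ∀ {s t u} → Σq ⊢q s ≈ t → Σq ⊢q t ≈ u → Σq ⊢q s ≈ u
    cong  : ∀ f {ts us : Fin (arity f) → Term} →
            (∀ i → Σq ⊢q ts i ≈ us i) → Σq ⊢q op f ts ≈ op f us
    subst : ∀ {s t} → Σq ⊢q s ≈ t → (σ : ℕ → Term) → Σq ⊢q sub σ s ≈ sub σ t
    rule  : ∀ {ps c} → Σq (ps ⇒ c) → (σ : ℕ → Term) →
            All (λ e → Σq ⊢q sub σ (proj₁ e) ≈ sub σ (proj₂ e)) ps →
            Σq ⊢q sub σ (proj₁ c) ≈ sub σ (proj₂ c)

  -- The equational theory of QMod Σq, given syntactically: the semantic one,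
  -- quantifying over all algebras, would not be a Theory (it lives in Set₁).
  Consequences : QTheory → Theory
  Consequences Σq (s , t) = Σq ⊢q s ≈ t

  ⊢q-sound : {Σq : QTheory} {A : Algebra} {s t : Term} →
             QMod Σq A → Σq ⊢q s ≈ t → A ⊨ (s , t)
  ⊢q-sound {A = A} A⊨Σq refl ρ = Setoid.refl (setoid A)
  ⊢q-sound {A = A} A⊨Σq (sym d) ρ = Setoid.sym (setoid A) (⊢q-sound {A = A} A⊨Σq d ρ)
  ⊢q-sound {A = A} A⊨Σq (trans d d′) ρ =
    Setoid.trans (setoid A) (⊢q-sound {A = A} A⊨Σq d ρ) (⊢q-sound {A = A} A⊨Σq d′ ρ)
  ⊢q-sound {A = A} A⊨Σq (cong f ds) ρ = ⟦⟧-cong A f (λ i → ⊢q-sound {A = A} A⊨Σq (ds i) ρ)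
  ⊢q-sound {A = A} A⊨Σq (subst {s} {t} d σ) ρ =
    HoldsAt-sub A ρ σ (s , t) (⊢q-sound {A = A} A⊨Σq d _)
  ⊢q-sound {A = A} A⊨Σq (rule {ps} {c} q σ ds) ρ =
    HoldsAt-sub A ρ σ c (A⊨Σq (ps ⇒ c) q _ (premises ds))
    where
    premises : ∀ {ps′} → All (λ e → _ ⊢q sub σ (proj₁ e) ≈ sub σ (proj₂ e)) ps′ →
               All (HoldsAt A (λ n → eval A ρ (σ n))) ps′
    premises []              = []
    premises (_∷_ {e} d ds′) = sub-HoldsAt A ρ σ e (⊢q-sound {A = A} A⊨Σq d ρ) ∷ premises ds′

  QMod⊆Mod-Consequences : (Σq : QTheory) → QMod Σq ⊆ Mod (Consequences Σq)
  QMod⊆Mod-Consequences Σq A A⊨Σq (s , t) d = ⊢q-sound {A = A} A⊨Σq d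

  Consequences⊢⇒⊢q : {Σq : QTheory} {s t : Term} → Consequences Σq ⊢ s ≈ t → Σq ⊢q s ≈ t
  Consequences⊢⇒⊢q (ax d σ)     = subst d σ
  Consequences⊢⇒⊢q refl         = refl
  Consequences⊢⇒⊢q (sym d)      = sym (Consequences⊢⇒⊢q d)
  Consequences⊢⇒⊢q (trans d d′) = trans (Consequences⊢⇒⊢q d) (Consequences⊢⇒⊢q d′)
  Consequences⊢⇒⊢q (cong f ds)  = cong f (λ i → Consequences⊢⇒⊢q (ds i))

  ⊢q⇒Consequences⊢ : {Σq : QTheory} {s t : Term} → Σq ⊢q s ≈ t → Consequences Σq ⊢ s ≈ t
  ⊢q⇒Consequences⊢ {Σq} {s} {t} d =
    trans (sym (sub-var E₀ s)) (trans (ax {s = s} {t = t} d var) (sub-var E₀ t))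
    where E₀ = Consequences Σq

  Free-Consequences∈QMod : (Σq : QTheory) → QMod Σq (Free (Consequences Σq))
  Free-Consequences∈QMod Σq (ps ⇒ (s , t)) q ρ hs =
    trans (eval-Free E₀ ρ s)
      (trans (⊢q⇒Consequences⊢ (rule q ρ (premises hs))) (sym (eval-Free E₀ ρ t)))
    where
    E₀ = Consequences Σq
    instanceOf : (e : Equation) → HoldsAt (Free E₀) ρ e → Σq ⊢q sub ρ (proj₁ e) ≈ sub ρ (proj₂ e)
    instanceOf (s′ , t′) h = Consequences⊢⇒⊢q
      (trans (sym (eval-Free E₀ ρ s′)) (trans h (eval-Free E₀ ρ t′)))
    premises : ∀ {ps′} → All (HoldsAt (Free E₀) ρ) ps′ →
               All (λ e → Σq ⊢q sub ρ (proj₁ e) ≈ sub ρ (proj₂ e)) ps′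
    premises []              = []
    premises (_∷_ {e} h hs′) = instanceOf e h ∷ premises hs′

  Mod∩⊆RelativeVariety : {Q K : Class} {E₀ : Theory} →
                         IsRelativeVariety Q K → K (Free E₀) → (Mod E₀ ∩ Q) ⊆ K
  Mod∩⊆RelativeVariety (W , (EW , W⊆Mod , Mod⊆W) , K⊆Q∩W , Q∩W⊆K) F₀∈K A (A⊨E₀ , A∈Q) =
    Q∩W⊆K A (A∈Q , Mod⊆W A (Free∈Mod⇒Mod⊆ F₀⊨EW A A⊨E₀))
    where F₀⊨EW = W⊆Mod _ (proj₂ (K⊆Q∩W _ F₀∈K))

  SubvarietyCondition : Theory → Set₁
  SubvarietyCondition E =
    (E₀ : Theory) → Mod E₀ ⊆ Mod E → QV E (Free E₀) → (Mod E₀ ∩ QV E) ≐ QV E₀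

  Primitive⇒SubvarietyCondition : (E : Theory) → Primitive (QV E) → SubvarietyCondition E
  Primitive⇒SubvarietyCondition E isPrimitive E₀ _ F₀∈QV = V₀∩QV⊆QV₀ , QV₀⊆V₀∩QV
    where
    QV₀⊆QV : QV E₀ ⊆ QV E
    QV₀⊆QV = QGen-least (Free E₀) F₀∈QV
    V₀∩QV⊆QV₀ : (Mod E₀ ∩ QV E) ⊆ QV E₀
    V₀∩QV⊆QV₀ = Mod∩⊆RelativeVariety
      (isPrimitive (QV E₀) (QGen-isQuasivariety (Free E₀)) QV₀⊆QV) (QGen-∈ (Free E₀))
    QV₀⊆V₀∩QV : QV E₀ ⊆ (Mod E₀ ∩ QV E)
    QV₀⊆V₀∩QV A A∈ = QV⊆Mod E₀ A A∈ , QV₀⊆QV A A∈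

  SubvarietyCondition⇒Primitive : (E : Theory) → SubvarietyCondition E → Primitive (QV E)
  SubvarietyCondition⇒Primitive E condition Q′ (Σq , Q′⊆QMod , QMod⊆Q′) Q′⊆QV =
    Mod E₀ , Mod-isVariety E₀ , Q′⊆QV∩V₀ , QV∩V₀⊆Q′
    where
    E₀ = Consequences Σq
    F₀∈QMod : QMod Σq (Free E₀)
    F₀∈QMod = Free-Consequences∈QMod Σq
    F₀∈QV : QV E (Free E₀)
    F₀∈QV = Q′⊆QV (Free E₀) (QMod⊆Q′ (Free E₀) F₀∈QMod)
    V₀⊆V : Mod E₀ ⊆ Mod E
    V₀⊆V = Free∈Mod⇒Mod⊆ (QV⊆Mod E (Free E₀) F₀∈QV)
    Q′⊆QV∩V₀ : Q′ ⊆ (QV E ∩ Mod E₀)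
    Q′⊆QV∩V₀ A A∈ = Q′⊆QV A A∈ , QMod⊆Mod-Consequences Σq A (Q′⊆QMod A A∈)
    QV∩V₀⊆Q′ : (QV E ∩ Mod E₀) ⊆ Q′
    QV∩V₀⊆Q′ A (A∈QV , A⊨E₀) = QMod⊆Q′ A
      (QGen-least (Free E₀) F₀∈QMod A (proj₁ (condition E₀ V₀⊆V F₀∈QV) A (A⊨E₀ , A∈QV)))

mainTheorem16 : (S : Signature) → let open Over S in
    (E : Theory) →
    Primitive (QV E)
      ⇔ ((E₀ : Theory) → Mod E₀ ⊆ Mod E → QV E (Free E₀) →
           (Mod E₀ ∩ QV E) ≐ QV E₀)
mainTheorem16 S E = mk⇔ (Primitive⇒SubvarietyCondition S E) (SubvarietyCondition⇒Primitive S E)
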